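{- Let $\pi$ be a propositional formula that is neither a tautology nor a contradiction. Then $\Box\bot\leftrightarrow[\dagger\pi]\Box\bot$ is valid, i.e. true at every world of every Kripke model.
   Context: Atoms come from a countable non-empty set $\mathit{At}$. A Kripke model $\mathcal M=\langle W,R,V\rangle$ has $W\neq\varnothing$, arbitrary $R\subseteq W\times W$, $V:\mathit{At}\to\mathcal P(W)$; $\mathcal M,w\models\Box\varphi$ iff $\mathcal M,v\models\varphi$ for all $v$ with $wRv$. A literal is an atom or its negation; a clause is a finite set $D$ of literals read as $\bigvee D$ ($\bigvee\varnothing=\bot$); it is tautological if it contains $p$ and $\neg p$ for some $p$. For propositional $\pi$, $\mathcal C(\pi)$ is the set of non-tautological clauses $D$ with $\models\pi\to\bigvee D$ such that no $D'\subsetneq D$ has $\models\pi\to\bigvee D'$. For a non-tautological clause $D$, $\mathcal M^{\{D\}}_u=\langle W',R',V'\rangle$ has $W'=W\times\{0,1\}$, $(w,i)R'(v,j)$ iff $wRv$, $(w,0)\in V'(p)$ iff $w\in V(p)$, and $(w,1)\in V'(p)$ iff $\neg p\in D$, or ($\{p,\neg p\}\cap D=\varnothing$ and $w\in V(p)$). Forgetting: $\mathcal M,w\models[\dagger\pi]\varphi$ iff for all $D\in\mathcal C(\pi)$, $\mathcal M^{\{D\}}_u,(w,0)\models\varphi$. -}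

module Defs where

open import Data.Bool using (Bool; true; false; _∧_; _∨_; not; T)
open import Data.Nat using (ℕ)
open import Data.Product using (_×_; _,_; Σ; proj₁; proj₂)
open import Data.Sum using (_⊎_)
open import Data.Empty using (⊥)
open import Data.List using (List)
open import Data.List.Relation.Unary.Any using (Any)
open import Data.List.Membership.Propositional using (_∈_)
open import Relation.Nullary using (¬_)
open import Relation.Binary.PropositionalEquality using (_≡_)

-- Atoms: an arbitrary type At (countability/non-emptiness are hypotheses
-- of the theorem).

module _ {At : Set} where

  data PForm : Set where
    patom : At → PForm
    p⊥ p⊤ : PForm
    p¬_ : PForm → PForm
    _p∧_ _p∨_ _p⇒_ : PForm → PForm → PForm

  Valuation : Set
  Valuation = At → Bool

  evalP : Valuation → PForm → Bool
  evalP v (patom p) = v p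
  evalP v p⊥ = false
  evalP v p⊤ = true
  evalP v (p¬ φ) = not (evalP v φ)
  evalP v (φ p∧ ψ) = evalP v φ ∧ evalP v ψ
  evalP v (φ p∨ ψ) = evalP v φ ∨ evalP v ψ
  evalP v (φ p⇒ ψ) = not (evalP v φ) ∨ evalP v ψ

  Tautology : PForm → Set
  Tautology π = ∀ (v : Valuation) → evalP v π ≡ true

  Contradiction : PForm → Set
  Contradiction π = ∀ (v : Valuation) → evalP v π ≡ false

  -- Literals and clauses (a clause is a finite set of literals,
  -- represented by a list read as the set of its members)

  data Literal : Set where
    pos : At → Literal
    neg : At → Literal

  Clause : Set
  Clause = List Literal

  evalL : Valuation → Literal → Bool
  evalL v (pos p) = v p
  evalL v (neg p) = not (v p)

  ClauseTrue : Valuation → Clause → Set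
  ClauseTrue v D = Any (λ l → T (evalL v l)) D

  Tautological : Clause → Set
  Tautological D = Σ At λ p → (pos p ∈ D) × (neg p ∈ D)

  Entails : PForm → Clause → Set
  Entails π D = ∀ (v : Valuation) → T (evalP v π) → ClauseTrue v D

  _⊆_ : Clause → Clause → Set
  D' ⊆ D = ∀ {l} → l ∈ D' → l ∈ D

  _⊊_ : Clause → Clause → Set
  D' ⊊ D = (D' ⊆ D) × ¬ (D ⊆ D')

  InC : PForm → Clause → Set
  InC π D = ¬ Tautological D × Entails π D
            × (∀ (D' : Clause) → D' ⊊ D → ¬ Entails π D')

  record Model : Set₁ where
    field
      W : Set
      R : W → W → Set
      V : At → W → Set
  open Model public

  -- the update model 𝓜^{D}_u, worlds W × {0,1} (false = 0, true = 1)
  update : Model → Clause → Model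
  update M D = record
    { W = W M × Bool
    ; R = λ { (w , i) (v , j) → R M w v }
    ; V = λ { p (w , false) → V M p w
            ; p (w , true) → (neg p ∈ D)
                 ⊎ (¬ (pos p ∈ D) × ¬ (neg p ∈ D) × V M p w) }
    }

  data MForm : Set where
    atom : At → MForm
    ⊥ₘ : MForm
    ¬ₘ_ : MForm → MForm
    _∧ₘ_ _∨ₘ_ _⇒ₘ_ _⇔ₘ_ : MForm → MForm → MForm
    □_ : MForm → MForm
    [†_]_ : PForm → MForm → MForm

  infixr 6 _⇔ₘ_
  infix 8 □_ [†_]_

  Sat : (M : Model) → W M → MForm → Set
  Sat M w (atom p) = V M p w
  Sat M w ⊥ₘ = ⊥
  Sat M w (¬ₘ φ) = ¬ Sat M w φ
  Sat M w (φ ∧ₘ ψ) = Sat M w φ × Sat M w ψ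
  Sat M w (φ ∨ₘ ψ) = Sat M w φ ⊎ Sat M w ψ
  Sat M w (φ ⇒ₘ ψ) = Sat M w φ → Sat M w ψ
  Sat M w (φ ⇔ₘ ψ) = (Sat M w φ → Sat M w ψ) × (Sat M w ψ → Sat M w φ)
  Sat M w (□ φ) = ∀ v → R M w v → Sat M v φ
  Sat M w ([† π ] φ) = ∀ (D : Clause) → InC π D → Sat (update M D) (w , false) φ

  Valid : MForm → Set₁
  Valid φ = ∀ (M : Model) (w : W M) → Sat M w φ

-- Updating with a clause D changes only valuations, while the accessibility
-- relation of the update model is that of the original model on first
-- components; so □⊥ holds at (w , 0) exactly when it holds at w, whatever D is.
-- [† π] □⊥ therefore agrees with □⊥ as soon as 𝒞(π) is non-empty. If π is not
-- a tautology, some valuation v₀ falsifies it; the clause of the literals over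
-- the atoms of π that are false under v₀ is then implied by π, and removing
-- literals one at a time while entailment persists yields a minimal implied
-- clause, which is non-tautological because v₀ still falsifies it.
module Submission where

open import Defs
open import Data.Bool using (Bool; true; false; not; _∧_; _∨_; T; if_then_else_)
open import Data.Bool.Properties using (T?; T-≡)
open import Data.Empty using (⊥-elim)
open import Data.List using (List; []; _∷_; _++_; map; filter; length)
open import Data.List.Properties using (filter-notAll)
open import Data.List.Membership.Propositional using (_∈_; _∉_; find; lose)
open import Data.List.Membership.Propositional.Properties
  using (∈-++⁺ˡ; ∈-++⁺ʳ; ∈-map⁺; ∈-map⁻; ∈-filter⁺; ∈-filter⁻)
open import Data.List.Relation.Binary.Subset.Propositional.Properties using (Any-resp-⊆)
import Data.List.Relation.Unary.Any as Any
open import Data.List.Relation.Unary.Any using (here; there; any?)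
import Data.List.Relation.Unary.All as All
open import Data.List.Relation.Unary.All.Properties using (¬All⇒Any¬)
open import Data.Nat using (ℕ; _<_)
open import Data.Nat.Induction using (<-wellFounded)
open import Data.Nat.Properties using (eq?)
open import Data.Product using (_×_; _,_; ∃; proj₁)
open import Data.Sum using (_⊎_; inj₁; inj₂)
open import Function using (_∘_; id)
open import Function.Bundles using (_↣_; Equivalence)
open import Induction.WellFounded using (Acc; acc)
open import Relation.Binary.Definitions using (DecidableEquality)
open import Relation.Binary.PropositionalEquality
  using (_≡_; refl; sym; cong; cong₂; subst)
open import Relation.Nullary using (¬_; Dec; yes; no; does; ¬?)
open import Relation.Nullary.Decidable using (map′; _→-dec_)

module _ {At : Set} where

  Agree : List At → Valuation {At} → Valuation {At} → Set
  Agree As v v' = ∀ {q} → q ∈ As → v q ≡ v' q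

  DependsOnlyOn : List At → (Valuation {At} → Set) → Set
  DependsOnlyOn As P = ∀ {v v'} → Agree As v v' → P v → P v'

  atoms : PForm {At} → List At
  atoms (patom p) = p ∷ []
  atoms p⊥ = []
  atoms p⊤ = []
  atoms (p¬ φ) = atoms φ
  atoms (φ p∧ ψ) = atoms φ ++ atoms ψ
  atoms (φ p∨ ψ) = atoms φ ++ atoms ψ
  atoms (φ p⇒ ψ) = atoms φ ++ atoms ψ

  evalP-cong : ∀ (φ : PForm {At}) {v v' : Valuation {At}} →
               Agree (atoms φ) v v' → evalP v φ ≡ evalP v' φ
  evalP-cong (patom p) ag = ag (here refl)
  evalP-cong p⊥ ag = refl
  evalP-cong p⊤ ag = refl
  evalP-cong (p¬ φ) ag = cong not (evalP-cong φ ag)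
  evalP-cong (φ p∧ ψ) ag = cong₂ _∧_ (evalP-cong φ (ag ∘ ∈-++⁺ˡ))
    (evalP-cong ψ (ag ∘ ∈-++⁺ʳ (atoms φ)))
  evalP-cong (φ p∨ ψ) ag = cong₂ _∨_ (evalP-cong φ (ag ∘ ∈-++⁺ˡ))
    (evalP-cong ψ (ag ∘ ∈-++⁺ʳ (atoms φ)))
  evalP-cong (φ p⇒ ψ) ag = cong₂ (λ a b → not a ∨ b) (evalP-cong φ (ag ∘ ∈-++⁺ˡ))
    (evalP-cong ψ (ag ∘ ∈-++⁺ʳ (atoms φ)))

  literalAtom : Literal {At} → At
  literalAtom (pos p) = p
  literalAtom (neg p) = p

  clauseAtoms : Clause {At} → List At
  clauseAtoms = map literalAtom

  evalL-cong : ∀ l {v v'} → v (literalAtom l) ≡ v' (literalAtom l) → evalL v l ≡ evalL v' l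
  evalL-cong (pos p) eq = eq
  evalL-cong (neg p) eq = cong not eq

  clauseTrue-cong : ∀ D → DependsOnlyOn (clauseAtoms D) (λ v → ClauseTrue v D)
  clauseTrue-cong D ag ct =
    let l , l∈D , t = find ct
    in lose l∈D (subst T (evalL-cong l (ag (∈-map⁺ literalAtom l∈D))) t)

  clauseTrue? : ∀ v (D : Clause {At}) → Dec (ClauseTrue v D)
  clauseTrue? v = any? (T? ∘ evalL v)

  tautological-true : ∀ {D : Clause {At}} v → Tautological D → ClauseTrue v D
  tautological-true v (p , p∈D , ¬p∈D) with v p in eq
  ... | true = lose p∈D (subst T (sym eq) _)
  ... | false = lose ¬p∈D (subst (T ∘ not) (sym eq) _)

  entails-mono : ∀ (π : PForm {At}) {D D'} → D ⊆ D' → Entails π D → Entails π D'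
  entails-mono π D⊆D' e v t = Any-resp-⊆ D⊆D' (e v t)

  Minimal : PForm {At} → Clause {At} → Set
  Minimal π D = ∀ D' → D' ⊊ D → ¬ Entails π D'

  falsifier : Valuation {At} → At → Literal {At}
  falsifier v₀ q = if v₀ q then neg q else pos q

  falsifier-false : ∀ v₀ (q : At) → ¬ T (evalL v₀ (falsifier v₀ q))
  falsifier-false v₀ q t with v₀ q in eq
  ... | true rewrite eq = t
  ... | false rewrite eq = t

  falsifier-agree : ∀ v₀ v (q : At) → ¬ T (evalL v (falsifier v₀ q)) → v q ≡ v₀ q
  falsifier-agree v₀ v q f with v₀ q | v q in eq
  ... | true | true = refl
  ... | true | false = ⊥-elim (f (subst (T ∘ not) (sym eq) _))
  ... | false | true = ⊥-elim (f (subst T (sym eq) _))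
  ... | false | false = refl

  falsifiedClause : Valuation {At} → List At → Clause {At}
  falsifiedClause v₀ = map (falsifier v₀)

  falsifiedClause-false : ∀ v₀ (As : List At) → ¬ ClauseTrue v₀ (falsifiedClause v₀ As)
  falsifiedClause-false v₀ As ct with find ct
  ... | l , l∈D , t with ∈-map⁻ (falsifier v₀) l∈D
  ... | q , _ , refl = falsifier-false v₀ q t

  falsifiedClause-entailed : ∀ (π : PForm {At}) v₀ → ¬ T (evalP v₀ π) →
                             Entails π (falsifiedClause v₀ (atoms π))
  falsifiedClause-entailed π v₀ ¬π v π-true with clauseTrue? v (falsifiedClause v₀ (atoms π))
  ... | yes ct = ct
  ... | no ¬ct = ⊥-elim (¬π (subst T (evalP-cong π agree) π-true))
    where
    agree : Agree (atoms π) v v₀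
    agree {q} q∈ = falsifier-agree v₀ v q (¬ct ∘ lose (∈-map⁺ (falsifier v₀) q∈))

module WithDecidableAtoms {At : Set} (_≟_ : DecidableEquality At) where

  _[_≔_] : Valuation {At} → At → Bool → Valuation {At}
  (v [ p ≔ b ]) q = if does (q ≟ p) then b else v q

  ≔-cong : ∀ {As v v'} p b → Agree As v v' → Agree (p ∷ As) (v [ p ≔ b ]) (v' [ p ≔ b ])
  ≔-cong p b ag {q} q∈ with q ≟ p | q∈
  ... | yes _ | _ = refl
  ... | no _ | there q∈As = ag q∈As
  ... | no q≢p | here q≡p = ⊥-elim (q≢p q≡p)

  ≔-self : ∀ {As} v p → Agree As (v [ p ≔ v p ]) v
  ≔-self v p {q} _ with q ≟ p
  ... | yes refl = refl
  ... | no _ = refl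

  -- Shannon expansion: fix the atoms of As one at a time to true and to false.
  all-or-counterexample : ∀ As {P : Valuation {At} → Set} → (∀ v → Dec (P v)) →
                          DependsOnlyOn As P → (∀ v → P v) ⊎ ∃ λ v → ¬ P v
  all-or-counterexample [] P? resp with P? (λ _ → false)
  ... | yes P₀ = inj₁ λ v → resp (λ ()) P₀
  ... | no ¬P₀ = inj₂ (_ , ¬P₀)
  all-or-counterexample (p ∷ As) {P} P? resp
    with all-or-counterexample As (P? ∘ _[ p ≔ true ]) (resp ∘ ≔-cong p true)
       | all-or-counterexample As (P? ∘ _[ p ≔ false ]) (resp ∘ ≔-cong p false)
  ... | inj₂ (_ , ¬P) | _ = inj₂ (_ , ¬P)
  ... | inj₁ _ | inj₂ (_ , ¬P) = inj₂ (_ , ¬P)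
  ... | inj₁ P-true | inj₁ P-false = inj₁ λ v → resp (≔-self v p) (P-at (v p) v)
    where
    P-at : ∀ b v → P (v [ p ≔ b ])
    P-at true = P-true
    P-at false = P-false

  countermodel : ∀ (π : PForm {At}) → ¬ Tautology π → ∃ λ v₀ → ¬ T (evalP v₀ π)
  countermodel π ¬taut
    with all-or-counterexample (atoms π) (λ v → T? (evalP v π)) (subst T ∘ evalP-cong π)
  ... | inj₁ taut = ⊥-elim (¬taut (Equivalence.to T-≡ ∘ taut))
  ... | inj₂ v₀ = v₀

  entails? : ∀ (π : PForm {At}) D → Dec (Entails π D)
  entails? π D
    with all-or-counterexample (atoms π ++ clauseAtoms D)
           (λ v → T? (evalP v π) →-dec clauseTrue? v D) resp
    where
    resp : DependsOnlyOn (atoms π ++ clauseAtoms D) (λ v → T (evalP v π) → ClauseTrue v D)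
    resp ag e π-true = clauseTrue-cong D (ag ∘ ∈-++⁺ʳ (atoms π))
      (e (subst T (evalP-cong π (sym ∘ ag ∘ ∈-++⁺ˡ)) π-true))
  ... | inj₁ e = yes e
  ... | inj₂ (v , ¬e) = no λ e → ¬e (e v)

  _≟ₗ_ : DecidableEquality (Literal {At})
  pos p ≟ₗ pos q = map′ (cong pos) (λ { refl → refl }) (p ≟ q)
  neg p ≟ₗ neg q = map′ (cong neg) (λ { refl → refl }) (p ≟ q)
  pos p ≟ₗ neg q = no λ ()
  neg p ≟ₗ pos q = no λ ()

  infixl 25 _without_

  _without_ : Clause {At} → Literal {At} → Clause {At}
  D without l = filter (λ m → ¬? (m ≟ₗ l)) D

  without-⊆ : ∀ {D l} → D without l ⊆ D
  without-⊆ = proj₁ ∘ ∈-filter⁻ _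

  ⊆-without : ∀ {D' D l} → D' ⊆ D → l ∉ D' → D' ⊆ D without l
  ⊆-without D'⊆D l∉D' m∈D' = ∈-filter⁺ _ (D'⊆D m∈D') λ { refl → l∉D' m∈D' }

  without-shorter : ∀ {D l} → l ∈ D → length (D without l) < length D
  without-shorter {D} l∈D = filter-notAll _ D (Any.map (λ { refl ¬l≡l → ¬l≡l refl }) l∈D)

  minimal-if-irredundant : ∀ (π : PForm {At}) D →
                           (∀ {l} → l ∈ D → ¬ Entails π (D without l)) → Minimal π D
  minimal-if-irredundant π D irredundant D' (D'⊆D , D⊈D') e'
    with All.all? (λ l → Any.any? (l ≟ₗ_) D') D
  ... | yes D⊆D' = D⊈D' (All.lookup D⊆D')
  ... | no not-all with find (¬All⇒Any¬ (λ l → Any.any? (l ≟ₗ_) D') D not-all)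
  ... | l , l∈D , l∉D' = irredundant l∈D (entails-mono π (⊆-without D'⊆D l∉D') e')

  minimise : ∀ (π : PForm {At}) D → Acc _<_ (length D) → Entails π D →
             ∃ λ D* → D* ⊆ D × Entails π D* × Minimal π D*
  minimise π D (acc smaller) e with any? (λ l → entails? π (D without l)) D
  ... | no irredundant =
    D , id , e , minimal-if-irredundant π D (λ l∈D e' → irredundant (lose l∈D e'))
  ... | yes removable with find removable
  ... | l , l∈D , e' with minimise π (D without l) (smaller (without-shorter l∈D)) e'
  ... | D* , D*⊆ , e* , minimal = D* , without-⊆ ∘ D*⊆ , e* , minimal

  primeImplicate : ∀ (π : PForm {At}) → ¬ Tautology π → ∃ (InC π)
  primeImplicate π ¬taut
    with v₀ , ¬π ← countermodel π ¬taut
    with D , D⊆ , e , minimal ← minimise π (falsifiedClause v₀ (atoms π)) (<-wellFounded _)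
                                   (falsifiedClause-entailed π v₀ ¬π)
    = D , (falsifiedClause-false v₀ (atoms π) ∘ Any-resp-⊆ D⊆ ∘ tautological-true v₀)
        , e , minimal

module _ {At : Set} (M : Model {At}) (D : Clause {At}) where

  □⊥-update : ∀ {w} b → Sat M w (□ ⊥ₘ) → Sat (update M D) (w , b) (□ ⊥ₘ)
  □⊥-update _ □⊥ (v , _) = □⊥ v

  □⊥-update⁻ : ∀ {w} b → Sat (update M D) (w , b) (□ ⊥ₘ) → Sat M w (□ ⊥ₘ)
  □⊥-update⁻ _ □⊥ v = □⊥ (v , false)

-- The injection into ℕ only makes equality of atoms decidable.
proposition18 : {At : Set} → (At ↣ ℕ) → At → (π : PForm {At}) →
    ¬ Tautology π → ¬ Contradiction π →
    Valid ((□ ⊥ₘ) ⇔ₘ ([† π ] (□ ⊥ₘ)))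
proposition18 inj _ π ¬taut _ M w = □⊥⇒forgotten , forgotten⇒□⊥
  where
  open WithDecidableAtoms (eq? inj)

  □⊥⇒forgotten : Sat M w (□ ⊥ₘ) → Sat M w ([† π ] (□ ⊥ₘ))
  □⊥⇒forgotten □⊥ D _ = □⊥-update M D false □⊥

  forgotten⇒□⊥ : Sat M w ([† π ] (□ ⊥ₘ)) → Sat M w (□ ⊥ₘ)
  forgotten⇒□⊥ forgotten with D , D∈𝒞 ← primeImplicate π ¬taut =
    □⊥-update⁻ M D false (forgotten D D∈𝒞)
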